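{- Let $\ell\ge1$ and let $(1,{\bf x})\in K^+_\ell(P)$. Let $S^1=\{j:x_j=1\}$. Then for every item $i\in[n]\setminus S^1$ with $c_i>C-\sum_{j\in S^1}c_j$, we have $x_i=0$.
   Context: A \textsc{Knapsack} instance has $n$ items, item $i\in[n]$ with nonnegative reward $r_i$ and nonnegative cost $c_i$, and capacity $C$; $P=\{{\bf x}\in[0,1]^n:\sum_ic_ix_i\le C\}$. $K^+_0(P)=\{(x_0,x_0{\bf x}):x_0\ge0,{\bf x}\in P\}$. For ${\bf y}$ indexed by subsets of $[n]$ of size at most $2$, the moment matrix $Y^{[{\bf y}]}$ is the $(n+1)\times(n+1)$ matrix with rows/columns indexed by $\emptyset,\{1\},\dots,\{n\}$ (identified with $0,\dots,n$) and $(A,B)$ entry $y_{A\cup B}$; ${\bf e}_0,\dots,{\bf e}_n$ is the standard basis. For $t\ge1$, $K^+_t(P)$ is the set of $(x_0,x_0{\bf x})$ for which there is ${\bf y}$ with $Y^{[{\bf y}]}\succeq0$, $(x_0,x_0{\bf x})=Y^{[{\bf y}]}{\bf e}_0$, and $Y^{[{\bf y}]}{\bf e}_i,\ Y^{[{\bf y}]}({\bf e}_0-{\bf e}_i)\in K^+_{t-1}(P)$ for all $i\in[n]$. -}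

module Defs where

open import Level using (Level; _⊔_) renaming (suc to lsuc)
open import Algebra.Bundles using (CommutativeRing)
open import Relation.Binary.Core using (Rel)
open import Relation.Binary.Structures using (IsTotalOrder)
open import Relation.Nullary using (¬_)
open import Data.Product using (Σ; ∃; _×_; _,_)
open import Data.Nat using (ℕ; zero; suc)
open import Data.Fin using (Fin; zero; suc)
open import Data.Fin.Properties using (<-cmp)
import Data.Fin as F
open import Data.Bool using (Bool; true; false; if_then_else_)
open import Relation.Binary.Definitions using (tri<; tri≈; tri>)

-- Ordered fields (the stdlib has neither reals nor ordered fields).
-- The paper works over ℝ; we state the result for every ordered field.

record OrderedField (c ℓ₁ ℓ₂ : Level) : Set (lsuc (c ⊔ ℓ₁ ⊔ ℓ₂)) where
  field
    commutativeRing : CommutativeRing c ℓ₁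
  open CommutativeRing commutativeRing public hiding (zero)
  field
    _≤_          : Rel Carrier ℓ₂
    isTotalOrder : IsTotalOrder _≈_ _≤_
    +-mono-≤     : ∀ {x y} z → x ≤ y → (x + z) ≤ (y + z)
    *-nonneg     : ∀ {x y} → 0# ≤ x → 0# ≤ y → 0# ≤ (x * y)
    0≉1          : ¬ (0# ≈ 1#)
    inverse      : ∀ x → ¬ (x ≈ 0#) → ∃ λ y → (x * y) ≈ 1#

  _<_ : Rel Carrier (ℓ₁ ⊔ ℓ₂)
  x < y = (x ≤ y) × ¬ (x ≈ y)

  sum : ∀ {n} → (Fin n → Carrier) → Carrier
  sum {zero}  f = 0#
  sum {suc n} f = f zero + sum (λ i → f (suc i))

data Sub₂ (n : ℕ) : Set where
  ∅    : Sub₂ n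
  single : Fin n → Sub₂ n
  pair : (i j : Fin n) → i F.< j → Sub₂ n

-- Rows/columns of the moment matrix: index 0 ↦ ∅, index (suc i) ↦ {i}.
-- unionIdx a b = (set of a) ∪ (set of b)
unionIdx : ∀ {n} → Fin (suc n) → Fin (suc n) → Sub₂ n
unionIdx zero    zero    = ∅
unionIdx zero    (suc j) = single j
unionIdx (suc i) zero    = single i
unionIdx (suc i) (suc j) with <-cmp i j
... | tri< i<j _ _ = pair i j i<j
... | tri≈ _ _ _   = single i
... | tri> _ _ j<i = pair j i j<i

module Knapsack {c ℓ₁ ℓ₂} (𝔽 : OrderedField c ℓ₁ ℓ₂) where
  open OrderedField 𝔽

  record Instance (n : ℕ) : Set (c ⊔ ℓ₂) where
    field
      r : Fin n → Carrier
      cost : Fin n → Carrier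
      C : Carrier
      r≥0 : ∀ i → 0# ≤ r i
      c≥0 : ∀ i → 0# ≤ cost i
      C≥0 : 0# ≤ C

  module _ {n : ℕ} (I : Instance n) where
    open Instance I

    InP : (Fin n → Carrier) → Set ℓ₂
    InP x = (∀ i → (0# ≤ x i) × (x i ≤ 1#)) × (sum (λ i → cost i * x i) ≤ C)

    Vec₁ : Set c
    Vec₁ = Fin (suc n) → Carrier

    K₀ : Vec₁ → Set (c ⊔ ℓ₁ ⊔ ℓ₂)
    K₀ v = Σ Carrier λ x₀ → Σ (Fin n → Carrier) λ x →
             (0# ≤ x₀) × InP x × (v zero ≈ x₀) × (∀ i → v (suc i) ≈ (x₀ * x i))

    Moment : (Sub₂ n → Carrier) → Fin (suc n) → Fin (suc n) → Carrier
    Moment y a b = y (unionIdx a b)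

    PSD : (Fin (suc n) → Fin (suc n) → Carrier) → Set (c ⊔ ℓ₂)
    PSD Y = ∀ (v : Vec₁) → 0# ≤ sum (λ a → sum (λ b → v a * (Y a b * v b)))

    col : (Fin (suc n) → Fin (suc n) → Carrier) → Fin (suc n) → Vec₁
    col Y b a = Y a b

    K : ℕ → Vec₁ → Set (c ⊔ ℓ₁ ⊔ ℓ₂)
    K zero    v = K₀ v
    K (suc t) v = Σ (Sub₂ n → Carrier) λ y →
        PSD (Moment y)
      × (∀ a → col (Moment y) zero a ≈ v a)
      × (∀ i → K t (col (Moment y) (suc i))
             × K t (λ a → col (Moment y) zero a - col (Moment y) (suc i) a))

    one∷ : (Fin n → Carrier) → Vec₁
    one∷ x zero    = 1#
    one∷ x (suc i) = x i

    costOf : (Fin n → Bool) → Carrier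
    costOf S = sum (λ j → if S j then cost j else 0#)

-- Every vector of K⁺_t(P) lies in the cone {v : 0 ≤ v_k ≤ v₀, Σ c_k v_k ≤ C v₀}, since a
-- vector of K⁺_{t+1} splits as Y e_i + Y(e₀ − e_i) and the cone is closed under addition.
-- Let (1, x) ∈ K⁺_{ℓ+1}(P) with moment vector y and fix i ∉ S¹.  For j ∈ S¹ the vector
-- Y(e₀ − e_j) has apex 1 − x_j = 0, so all its coordinates vanish, giving y_{ij} = y_i.
-- The column Y e_i then yields y_i (c_i + Σ_{S¹} c_j) ≤ Σ_k c_k y_{ik} ≤ C y_i, and since
-- C < c_i + Σ_{S¹} c_j and y_i ≥ 0 this forces x_i = y_i = 0.
module Submission where

open import Defs
open import Level using (Level)
open import Data.Nat using (ℕ; zero; suc)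
open import Data.Fin using (Fin; zero; suc)
import Data.Fin.Properties as Fin
import Data.Nat.Properties as ℕ
open import Data.Bool using (Bool; true; false; if_then_else_)
open import Data.Bool.Properties using (¬-not)
open import Data.Product using (_×_; _,_; proj₁; proj₂)
open import Data.Empty using (⊥-elim)
open import Function.Base using (_∘′_)
open import Function.Bundles using (_⇔_; module Equivalence)
open import Relation.Nullary using (¬_)
open import Relation.Binary.Bundles using (Poset)
open import Relation.Binary.Definitions using (tri<; tri≈; tri>)
open import Relation.Binary.Structures using (IsTotalOrder)
open import Relation.Binary.PropositionalEquality as ≡ using (_≡_)
import Relation.Binary.Reasoning.PartialOrder as PartialOrderReasoning
import Algebra.Properties.Ring as RingProperties
import Algebra.Properties.CommutativeSemigroup as CommutativeSemigroupProperties
import Algebra.Properties.Semiring.Sum as SemiringSum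

unionIdx-comm : ∀ {n} (a b : Fin (suc n)) → unionIdx a b ≡ unionIdx b a
unionIdx-comm zero    zero    = ≡.refl
unionIdx-comm zero    (suc j) = ≡.refl
unionIdx-comm (suc i) zero    = ≡.refl
unionIdx-comm (suc i) (suc j) with Fin.<-cmp i j | Fin.<-cmp j i
... | tri< i<j _ _ | tri> _ _ i<j′ = ≡.cong (pair i j) (ℕ.<-irrelevant i<j i<j′)
... | tri≈ _ i≡j _ | tri≈ _ _ _    = ≡.cong single i≡j
... | tri> _ _ j<i | tri< j<i′ _ _ = ≡.cong (pair j i) (ℕ.<-irrelevant j<i j<i′)
... | tri< i<j _ _ | tri< _ _ j≮i  = ⊥-elim (j≮i i<j)
... | tri< _ i≢j _ | tri≈ _ j≡i _  = ⊥-elim (i≢j (≡.sym j≡i))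
... | tri≈ _ i≡j _ | tri< _ j≢i _  = ⊥-elim (j≢i (≡.sym i≡j))
... | tri≈ _ i≡j _ | tri> _ j≢i _  = ⊥-elim (j≢i (≡.sym i≡j))
... | tri> _ i≢j _ | tri≈ _ j≡i _  = ⊥-elim (i≢j (≡.sym j≡i))
... | tri> _ _ j<i | tri> i≮j _ _  = ⊥-elim (i≮j j<i)

unionIdx-diag : ∀ {n} (i : Fin n) → unionIdx (suc i) (suc i) ≡ single i
unionIdx-diag i with Fin.<-cmp i i
... | tri< _ i≢i _ = ⊥-elim (i≢i ≡.refl)
... | tri≈ _ _ _   = ≡.refl
... | tri> _ i≢i _ = ⊥-elim (i≢i ≡.refl)

module OrderedFieldProperties {c ℓ₁ ℓ₂} (𝔽 : OrderedField c ℓ₁ ℓ₂) where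
  open OrderedField 𝔽
  open CommutativeSemigroupProperties +-commutativeSemigroup using (x∙yz≈y∙xz)
  open RingProperties ring
    using (x[y-z]≈xy-xz; x∙y⁻¹≈ε⇒x≈y; //-rightDividesˡ; //-rightDividesʳ)
  private module ∑ = SemiringSum semiring

  poset : Poset c ℓ₁ ℓ₂
  poset = record { isPartialOrder = IsTotalOrder.isPartialOrder isTotalOrder }

  open Poset poset public using (≤-respˡ-≈; ≤-respʳ-≈)
    renaming (refl to ≤-refl; antisym to ≤-antisym)
  module ≤-Reasoning = PartialOrderReasoning poset
  open ≤-Reasoning

  +-monoʳ-≤ : ∀ z {x y} → x ≤ y → (z + x) ≤ (z + y)
  +-monoʳ-≤ z {x} {y} x≤y = begin
    z + x  ≈⟨ +-comm z x ⟩
    x + z  ≤⟨ +-mono-≤ z x≤y ⟩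
    y + z  ≈⟨ +-comm y z ⟩
    z + y  ∎

  +-mono₂-≤ : ∀ {x y u v} → x ≤ y → u ≤ v → (x + u) ≤ (y + v)
  +-mono₂-≤ {x} {y} {u} {v} x≤y u≤v = begin
    x + u  ≤⟨ +-mono-≤ u x≤y ⟩
    y + u  ≤⟨ +-monoʳ-≤ y u≤v ⟩
    y + v  ∎

  x≤y⇒0≤y-x : ∀ {x y} → x ≤ y → 0# ≤ (y - x)
  x≤y⇒0≤y-x {x} {y} x≤y = begin
    0#     ≈⟨ -‿inverseʳ x ⟨
    x - x  ≤⟨ +-mono-≤ (- x) x≤y ⟩
    y - x  ∎

  0≤y-x⇒x≤y : ∀ {x y} → 0# ≤ (y - x) → x ≤ y
  0≤y-x⇒x≤y {x} {y} 0≤y-x = begin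
    x            ≈⟨ +-identityˡ x ⟨
    0# + x       ≤⟨ +-mono-≤ x 0≤y-x ⟩
    (y - x) + x  ≈⟨ //-rightDividesˡ x y ⟩
    y            ∎

  *-monoˡ-≤-nonneg : ∀ {z x y} → 0# ≤ z → x ≤ y → (z * x) ≤ (z * y)
  *-monoˡ-≤-nonneg {z} {x} {y} 0≤z x≤y = 0≤y-x⇒x≤y (begin
    0#              ≤⟨ *-nonneg 0≤z (x≤y⇒0≤y-x x≤y) ⟩
    z * (y - x)     ≈⟨ x[y-z]≈xy-xz z y x ⟩
    z * y - z * x   ∎)

  x+[y-x]≈y : ∀ x y → (x + (y - x)) ≈ y
  x+[y-x]≈y x y = trans (+-comm x (y - x)) (//-rightDividesˡ x y)

  x-y<z⇒x<z+y : ∀ {x y z} → (x - y) < z → x < (z + y)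
  x-y<z⇒x<z+y {x} {y} {z} (x-y≤z , x-y≉z) = x≤z+y , x-y≉z ∘′ x≈z+y⇒x-y≈z
    where
    x≤z+y : x ≤ (z + y)
    x≤z+y = begin
      x            ≈⟨ //-rightDividesˡ y x ⟨
      (x - y) + y  ≤⟨ +-mono-≤ y x-y≤z ⟩
      z + y        ∎
    x≈z+y⇒x-y≈z : x ≈ (z + y) → (x - y) ≈ z
    x≈z+y⇒x-y≈z x≈z+y = trans (+-congʳ x≈z+y) (//-rightDividesʳ y z)

  x*y≈0⇒x≈0 : ∀ {x y} → ¬ (y ≈ 0#) → (x * y) ≈ 0# → x ≈ 0#
  x*y≈0⇒x≈0 {x} {y} y≉0 xy≈0 with inverse y y≉0
  ... | y⁻¹ , yy⁻¹≈1 = begin-equality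
    x              ≈⟨ *-identityʳ x ⟨
    x * 1#         ≈⟨ *-congˡ yy⁻¹≈1 ⟨
    x * (y * y⁻¹)  ≈⟨ *-assoc x y y⁻¹ ⟨
    (x * y) * y⁻¹  ≈⟨ *-congʳ xy≈0 ⟩
    0# * y⁻¹       ≈⟨ zeroˡ y⁻¹ ⟩
    0#             ∎

  x*v≤x*u∧u<v⇒x≈0 : ∀ {x u v} → 0# ≤ x → (x * v) ≤ (x * u) → u < v → x ≈ 0#
  x*v≤x*u∧u<v⇒x≈0 {x} {u} {v} 0≤x xv≤xu (u≤v , u≉v) =
    x*y≈0⇒x≈0 (λ v-u≈0 → u≉v (sym (x∙y⁻¹≈ε⇒x≈y v u v-u≈0)))
      (≤-antisym x[v-u]≤0 (*-nonneg 0≤x (x≤y⇒0≤y-x u≤v)))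
    where
    x[v-u]≤0 : (x * (v - u)) ≤ 0#
    x[v-u]≤0 = begin
      x * (v - u)    ≈⟨ x[y-z]≈xy-xz x v u ⟩
      x * v - x * u  ≤⟨ +-mono-≤ (- (x * u)) xv≤xu ⟩
      x * u - x * u  ≈⟨ -‿inverseʳ (x * u) ⟩
      0#             ∎

  sum≈∑ : ∀ {n} (f : Fin n → Carrier) → sum f ≈ ∑.sum f
  sum≈∑ {zero}  f = refl
  sum≈∑ {suc n} f = +-congˡ (sum≈∑ (λ k → f (suc k)))

  sum-cong : ∀ {n} {f g : Fin n → Carrier} → (∀ k → f k ≈ g k) → sum f ≈ sum g
  sum-cong {f = f} {g} f≈g = begin-equality
    sum f    ≈⟨ sum≈∑ f ⟩
    ∑.sum f  ≈⟨ ∑.sum-cong-≋ f≈g ⟩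
    ∑.sum g  ≈⟨ sum≈∑ g ⟨
    sum g    ∎

  sum-distrib-+ : ∀ {n} (f g : Fin n → Carrier) → sum (λ k → f k + g k) ≈ (sum f + sum g)
  sum-distrib-+ f g = begin-equality
    sum (λ k → f k + g k)    ≈⟨ sum≈∑ (λ k → f k + g k) ⟩
    ∑.sum (λ k → f k + g k)  ≈⟨ ∑.∑-distrib-+ f g ⟩
    ∑.sum f + ∑.sum g        ≈⟨ +-cong (sum≈∑ f) (sum≈∑ g) ⟨
    sum f + sum g            ∎

  *-distribˡ-sum : ∀ {n} x (f : Fin n → Carrier) → (x * sum f) ≈ sum (λ k → x * f k)
  *-distribˡ-sum x f = begin-equality
    x * sum f              ≈⟨ *-congˡ (sum≈∑ f) ⟩
    x * ∑.sum f            ≈⟨ ∑.*-distribˡ-sum x f ⟩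
    ∑.sum (λ k → x * f k)  ≈⟨ sum≈∑ (λ k → x * f k) ⟨
    sum (λ k → x * f k)    ∎

  sum-mono-≤ : ∀ {n} {f g : Fin n → Carrier} → (∀ k → f k ≤ g k) → sum f ≤ sum g
  sum-mono-≤ {zero}  f≤g = ≤-refl
  sum-mono-≤ {suc n} f≤g = +-mono₂-≤ (f≤g zero) (sum-mono-≤ (λ k → f≤g (suc k)))

  sum-mono-≤-with-gap : ∀ {n} {f g : Fin n → Carrier} {δ} (i : Fin n) →
                        (∀ k → f k ≤ g k) → (δ + f i) ≤ g i → (δ + sum f) ≤ sum g
  sum-mono-≤-with-gap {f = f} {g} {δ} zero f≤g gap = begin
    δ + (f zero + sum (λ k → f (suc k)))  ≈⟨ +-assoc δ _ _ ⟨
    (δ + f zero) + sum (λ k → f (suc k))  ≤⟨ +-mono₂-≤ gap (sum-mono-≤ (λ k → f≤g (suc k))) ⟩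
    g zero + sum (λ k → g (suc k))        ∎
  sum-mono-≤-with-gap {f = f} {g} {δ} (suc i) f≤g gap = begin
    δ + (f zero + sum (λ k → f (suc k)))  ≈⟨ x∙yz≈y∙xz δ _ _ ⟩
    f zero + (δ + sum (λ k → f (suc k)))
      ≤⟨ +-mono₂-≤ (f≤g zero) (sum-mono-≤-with-gap i (λ k → f≤g (suc k)) gap) ⟩
    g zero + sum (λ k → g (suc k))        ∎

module KnapsackProperties {c ℓ₁ ℓ₂} (𝔽 : OrderedField c ℓ₁ ℓ₂) {n : ℕ}
                          (I : Knapsack.Instance 𝔽 n) where
  open OrderedField 𝔽
  open OrderedFieldProperties 𝔽
  open Knapsack 𝔽
  open Instance I
  open ≤-Reasoning
  open CommutativeSemigroupProperties *-commutativeSemigroup using (x∙yz≈y∙xz)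
  open RingProperties ring using (x∙y⁻¹≈ε⇒x≈y; x≈y⇒x∙y⁻¹≈ε)

  -- K⁺₀(P) without the witness x; the two sets agree, but only K₀ ⊆ Cone is needed.
  record Cone (v : Vec₁ I) : Set ℓ₂ where
    field
      apex-nonneg   : 0# ≤ v zero
      coord-nonneg  : ∀ k → 0# ≤ v (suc k)
      coord≤apex    : ∀ k → v (suc k) ≤ v zero
      cost≤capacity : sum (λ k → cost k * v (suc k)) ≤ (C * v zero)

  open Cone public

  Cone-resp : ∀ {u v : Vec₁ I} → (∀ a → u a ≈ v a) → Cone u → Cone v
  Cone-resp {u} {v} u≈v u∈Cone = record
    { apex-nonneg   = ≤-respʳ-≈ (u≈v zero) (apex-nonneg u∈Cone)
    ; coord-nonneg  = λ k → ≤-respʳ-≈ (u≈v (suc k)) (coord-nonneg u∈Cone k)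
    ; coord≤apex    = λ k → ≤-respˡ-≈ (u≈v (suc k)) (≤-respʳ-≈ (u≈v zero) (coord≤apex u∈Cone k))
    ; cost≤capacity = ≤-respˡ-≈ (sum-cong (λ k → *-congˡ (u≈v (suc k))))
                        (≤-respʳ-≈ (*-congˡ (u≈v zero)) (cost≤capacity u∈Cone))
    }

  Cone-+ : ∀ {u v : Vec₁ I} → Cone u → Cone v → Cone (λ a → u a + v a)
  Cone-+ {u} {v} u∈Cone v∈Cone = record
    { apex-nonneg   = ≤-respˡ-≈ (+-identityˡ 0#)
                              (+-mono₂-≤ (apex-nonneg u∈Cone) (apex-nonneg v∈Cone))
    ; coord-nonneg  = λ k → ≤-respˡ-≈ (+-identityˡ 0#)
                              (+-mono₂-≤ (coord-nonneg u∈Cone k) (coord-nonneg v∈Cone k))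
    ; coord≤apex    = λ k → +-mono₂-≤ (coord≤apex u∈Cone k) (coord≤apex v∈Cone k)
    ; cost≤capacity = begin
        sum (λ k → cost k * (u (suc k) + v (suc k)))
          ≈⟨ sum-cong (λ k → distribˡ (cost k) (u (suc k)) (v (suc k))) ⟩
        sum (λ k → cost k * u (suc k) + cost k * v (suc k))
          ≈⟨ sum-distrib-+ (λ k → cost k * u (suc k)) (λ k → cost k * v (suc k)) ⟩
        sum (λ k → cost k * u (suc k)) + sum (λ k → cost k * v (suc k))
          ≤⟨ +-mono₂-≤ (cost≤capacity u∈Cone) (cost≤capacity v∈Cone) ⟩
        C * u zero + C * v zero
          ≈⟨ distribˡ C (u zero) (v zero) ⟨
        C * (u zero + v zero) ∎
    }

  K₀⊆Cone : ∀ {v} → K₀ I v → Cone v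
  K₀⊆Cone {v} (x₀ , x , 0≤x₀ , (x∈[0,1] , x∈P) , v₀≈x₀ , vₖ≈x₀xₖ) = record
    { apex-nonneg   = ≤-respʳ-≈ (sym v₀≈x₀) 0≤x₀
    ; coord-nonneg  = λ k → ≤-respʳ-≈ (sym (vₖ≈x₀xₖ k)) (*-nonneg 0≤x₀ (proj₁ (x∈[0,1] k)))
    ; coord≤apex    = λ k → begin
        v (suc k)  ≈⟨ vₖ≈x₀xₖ k ⟩
        x₀ * x k   ≤⟨ *-monoˡ-≤-nonneg 0≤x₀ (proj₂ (x∈[0,1] k)) ⟩
        x₀ * 1#    ≈⟨ *-identityʳ x₀ ⟩
        x₀         ≈⟨ v₀≈x₀ ⟨
        v zero     ∎
    ; cost≤capacity = begin
        sum (λ k → cost k * v (suc k))  ≈⟨ sum-cong (λ k → *-congˡ (vₖ≈x₀xₖ k)) ⟩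
        sum (λ k → cost k * (x₀ * x k)) ≈⟨ sum-cong (λ k → x∙yz≈y∙xz (cost k) x₀ (x k)) ⟩
        sum (λ k → x₀ * (cost k * x k)) ≈⟨ *-distribˡ-sum x₀ (λ k → cost k * x k) ⟨
        x₀ * sum (λ k → cost k * x k)   ≤⟨ *-monoˡ-≤-nonneg 0≤x₀ x∈P ⟩
        x₀ * C                          ≈⟨ *-comm x₀ C ⟩
        C * x₀                          ≈⟨ *-congˡ v₀≈x₀ ⟨
        C * v zero                      ∎
    }

  -- The item is needed to split a vector of K⁺_{t+1} as Y e_i + Y(e₀ − e_i).
  K⊆Cone : Fin n → ∀ t {v} → K I t v → Cone v
  K⊆Cone i zero    v∈K₀ = K₀⊆Cone v∈K₀
  K⊆Cone i (suc t) (y , _ , col₀≈v , split) =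
    Cone-resp (λ a → trans (x+[y-x]≈y (col I Y (suc i) a) (col I Y zero a)) (col₀≈v a))
              (Cone-+ (K⊆Cone i t (proj₁ (split i))) (K⊆Cone i t (proj₂ (split i))))
    where
    Y = Moment I y

  Cone-apex≈0 : ∀ {v} → Cone v → v zero ≈ 0# → ∀ k → v (suc k) ≈ 0#
  Cone-apex≈0 v∈Cone v₀≈0 k =
    ≤-antisym (≤-respʳ-≈ v₀≈0 (coord≤apex v∈Cone k)) (coord-nonneg v∈Cone k)

  module _ {t : ℕ} {v : Vec₁ I} {y : Sub₂ n → Carrier}
           (col₀≈v : ∀ a → col I (Moment I y) zero a ≈ v a)
           (split : ∀ i → K I t (col I (Moment I y) (suc i))
                        × K I t (λ a → col I (Moment I y) zero a - col I (Moment I y) (suc i) a))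
           where

    moment-pair≈moment-single : ∀ i j → v (suc j) ≈ v zero →
                                y (unionIdx (suc j) (suc i)) ≈ y (single i)
    moment-pair≈moment-single i j vⱼ≈v₀ = begin-equality
      y (unionIdx (suc j) (suc i))  ≡⟨ ≡.cong y (unionIdx-comm (suc j) (suc i)) ⟩
      y (unionIdx (suc i) (suc j))  ≈⟨ x∙y⁻¹≈ε⇒x≈y _ _ yᵢ-yᵢⱼ≈0 ⟨
      y (single i)                  ∎
      where
      apex≈0 : (y ∅ - y (single j)) ≈ 0#
      apex≈0 = x≈y⇒x∙y⁻¹≈ε (trans (col₀≈v zero) (trans (sym vⱼ≈v₀) (sym (col₀≈v (suc j)))))
      yᵢ-yᵢⱼ≈0 : (y (single i) - y (unionIdx (suc i) (suc j))) ≈ 0#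
      yᵢ-yᵢⱼ≈0 = Cone-apex≈0 (K⊆Cone i t (proj₂ (split j))) apex≈0 i

    moment-cost-bound : (S : Fin n → Bool) → (∀ j → S j ≡ true → v (suc j) ≈ v zero) →
                        ∀ i → ¬ (S i ≡ true) →
                        (y (single i) * (cost i + costOf I S)) ≤ (y (single i) * C)
    moment-cost-bound S S-saturated i i∉S = begin
      yᵢ * (cost i + costOf I S)                         ≈⟨ distribˡ yᵢ (cost i) (costOf I S) ⟩
      yᵢ * cost i + yᵢ * costOf I S                      ≈⟨ +-congˡ (*-distribˡ-sum yᵢ costₛ) ⟩
      yᵢ * cost i + sum (λ k → yᵢ * costₛ k)             ≤⟨ sum-mono-≤-with-gap i yᵢcostₛ≤ gapᵢ ⟩
      sum (λ k → cost k * y (unionIdx (suc k) (suc i)))  ≤⟨ cost≤capacity colᵢ∈Cone ⟩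
      C * yᵢ                                             ≈⟨ *-comm C yᵢ ⟩
      yᵢ * C                                             ∎
      where
      yᵢ : Carrier
      yᵢ = y (single i)
      costₛ : Fin n → Carrier
      costₛ k = if S k then cost k else 0#
      colᵢ∈Cone : Cone (col I (Moment I y) (suc i))
      colᵢ∈Cone = K⊆Cone i t (proj₁ (split i))
      yᵢcostₛ≤ : ∀ k → (yᵢ * costₛ k) ≤ (cost k * y (unionIdx (suc k) (suc i)))
      yᵢcostₛ≤ k with S k in k∈S
      ... | true  = begin
        yᵢ * cost k                            ≈⟨ *-comm yᵢ (cost k) ⟩
        cost k * yᵢ                            ≈⟨ *-congˡ yₖᵢ≈yᵢ ⟨
        cost k * y (unionIdx (suc k) (suc i))  ∎
        where
        yₖᵢ≈yᵢ : y (unionIdx (suc k) (suc i)) ≈ yᵢ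
        yₖᵢ≈yᵢ = moment-pair≈moment-single i k (S-saturated k k∈S)
      ... | false = ≤-respˡ-≈ (sym (zeroʳ yᵢ)) (*-nonneg (c≥0 k) (coord-nonneg colᵢ∈Cone k))
      gapᵢ : (yᵢ * cost i + yᵢ * costₛ i) ≤ (cost i * y (unionIdx (suc i) (suc i)))
      gapᵢ rewrite ¬-not i∉S | unionIdx-diag i = begin
        yᵢ * cost i + yᵢ * 0#  ≈⟨ +-congˡ (zeroʳ yᵢ) ⟩
        yᵢ * cost i + 0#       ≈⟨ +-identityʳ (yᵢ * cost i) ⟩
        yᵢ * cost i            ≈⟨ *-comm yᵢ (cost i) ⟩
        cost i * yᵢ            ∎

lemma9 : ∀ {c ℓ₁ ℓ₂ : Level} (𝔽 : OrderedField c ℓ₁ ℓ₂) {n : ℕ}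
    (I : Knapsack.Instance 𝔽 n) (ℓ : ℕ) (x : Fin n → OrderedField.Carrier 𝔽) →
    Knapsack.K 𝔽 I (suc ℓ) (Knapsack.one∷ 𝔽 I x) →
    (S¹ : Fin n → Bool) →
    (∀ j → (S¹ j ≡ true) ⇔ OrderedField._≈_ 𝔽 (x j) (OrderedField.1# 𝔽)) →
    ∀ i → ¬ (S¹ i ≡ true) →
    OrderedField._<_ 𝔽
    (OrderedField._-_ 𝔽 (Knapsack.Instance.C I) (Knapsack.costOf 𝔽 I S¹))
    (Knapsack.Instance.cost I i) →
    OrderedField._≈_ 𝔽 (x i) (OrderedField.0# 𝔽)
lemma9 𝔽 I ℓ x (y , _ , col₀≈v , split) S¹ S¹-saturated i i∉S¹ C-costₛ<costᵢ = begin-equality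
  x i           ≈⟨ col₀≈v (suc i) ⟨
  y (single i)  ≈⟨ x*v≤x*u∧u<v⇒x≈0 yᵢ≥0 cost-bound (x-y<z⇒x<z+y C-costₛ<costᵢ) ⟩
  0#            ∎
  where
  open OrderedField 𝔽
  open OrderedFieldProperties 𝔽
  open Knapsack 𝔽
  open Instance I
  open KnapsackProperties 𝔽 I
  open ≤-Reasoning
  yᵢ≥0 : 0# ≤ y (single i)
  yᵢ≥0 = apex-nonneg (K⊆Cone i ℓ (proj₁ (split i)))
  cost-bound : (y (single i) * (cost i + costOf I S¹)) ≤ (y (single i) * C)
  cost-bound =
    moment-cost-bound {y = y} col₀≈v split S¹ (λ j → Equivalence.to (S¹-saturated j)) i i∉S¹
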